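{- For all integers $t\geq 4$ and $s\geq 3$, $\mathrm{oh}(K_t\times K_s)\geq t\lfloor s/3\rfloor$.
   Context: $\mathrm{oh}(G)$ (Odd Hadwiger number) of a finite simple graph $G$ is the largest integer $m$ for which there exist $m$ pairwise vertex-disjoint trees $Z_1,\dots,Z_m$ in $G$ and a 2-colouring $c$ of $V(Z_1)\cup\dots\cup V(Z_m)$ that is proper on each $Z_k$, such that for every $k\neq k'$ there is an edge $xy\in E(G)$ with $x\in V(Z_k)$, $y\in V(Z_{k'})$, $c(x)=c(y)$. The direct product $G\times H$ has vertex set $V(G)\times V(H)$, with $(v_1,u_1)\sim(v_2,u_2)$ iff $v_1v_2\in E(G)$ and $u_1u_2\in E(H)$. -}

module Defs where

open import Data.Nat using (ℕ; suc; _≤_)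
open import Data.Fin using (Fin)
open import Data.Bool using (Bool)
open import Data.Maybe using (just)
open import Data.Product using (Σ; ∃; _×_; _,_)
open import Data.List using (List; []; _∷_; length; head; last)
open import Data.List.Relation.Unary.Unique.Propositional using (Unique)
open import Relation.Nullary using (¬_)
open import Relation.Binary.PropositionalEquality using (_≡_; _≢_; refl; sym)

record Graph : Set₁ where
  field
    V      : Set
    Adj    : V → V → Set
    adj-sym    : ∀ {x y} → Adj x y → Adj y x
    adj-irrefl : ∀ {x} → ¬ Adj x x
open Graph public

K : ℕ → Graph
K n = record
  { V = Fin n
  ; Adj = λ i j → i ≢ j
  ; adj-sym = λ p q → p (sym q)
  ; adj-irrefl = λ p → p refl }

_⊗_ : Graph → Graph → Graph
G ⊗ H = record
  { V = V G × V H
  ; Adj = λ { (v₁ , u₁) (v₂ , u₂) → Adj G v₁ v₂ × Adj H u₁ u₂ }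
  ; adj-sym = λ { (a , b) → adj-sym G a , adj-sym H b }
  ; adj-irrefl = λ { (a , b) → adj-irrefl G a } }

record Subgraph (G : Graph) : Set₁ where
  field
    Vs      : V G → Set
    Es      : V G → V G → Set
    Es-sym  : ∀ {x y} → Es x y → Es y x
    Es-adj  : ∀ {x y} → Es x y → Adj G x y
    Es-vert : ∀ {x y} → Es x y → Vs x × Vs y
open Subgraph public

data Walk {G : Graph} (Z : Subgraph G) : V G → V G → Set where
  here : ∀ {x} → Walk Z x x
  step : ∀ {x y z} → Es Z x y → Walk Z y z → Walk Z x z

data Chain {G : Graph} (Z : Subgraph G) : List (V G) → Set where
  nil  : Chain Z []
  one  : ∀ {x} → Chain Z (x ∷ [])
  cons : ∀ {x y vs} → Es Z x y → Chain Z (y ∷ vs) → Chain Z (x ∷ y ∷ vs)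

record Cycle {G : Graph} (Z : Subgraph G) : Set where
  field
    first  : V G
    rest   : List (V G)
    len≥3  : 3 ≤ suc (length rest)
    distinct : Unique (first ∷ rest)
    chain  : Chain Z (first ∷ rest)
    closing : ∃ λ l → last (first ∷ rest) ≡ just l × Es Z l first

record IsTree {G : Graph} (Z : Subgraph G) : Set where
  field
    nonempty  : ∃ λ x → Vs Z x
    connected : ∀ {x y} → Vs Z x → Vs Z y → Walk Z x y
    acyclic   : ¬ Cycle Z

-- An odd K_m minor model in G (witness that oh(G) ≥ m): pairwise
-- vertex-disjoint trees Z₁ … Z_m and a 2-colouring c (defined on all of V G;
-- only its values on the trees matter) that is proper on every tree edge, such
-- that any two distinct trees are joined by an edge of G whose ends get the
-- same colour.
record OddKMinorModel (G : Graph) (m : ℕ) : Set₁ where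
  field
    Z        : Fin m → Subgraph G
    trees    : ∀ k → IsTree (Z k)
    disjoint : ∀ {k k'} → k ≢ k' → ∀ x → Vs (Z k) x → ¬ Vs (Z k') x
    colour   : V G → Bool
    proper   : ∀ k {x y} → Es (Z k) x y → colour x ≢ colour y
    monochromatic-link : ∀ {k k'} → k ≢ k' →
      ∃ λ x → ∃ λ y → Vs (Z k) x × Vs (Z k') y × Adj G x y × colour x ≡ colour y

oh≥ : Graph → ℕ → Set₁
oh≥ G m = ∃ λ m' → m ≤ m' × OddKMinorModel G m'

-- Take t⌊s/3⌋ vertex-disjoint paths on three vertices in K_t × K_s: for a row i
-- and a block b of three columns, the path runs (i, 3b) — (σ²i, 3b+1) — (σi, 3b+2),
-- where σ rotates the rows cyclically. Colouring the middle vertices of all paths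
-- differently from everything else is proper on every path, and ends of any two
-- paths receive the same colour. Since t ≥ 3, σ has no fixed points and no
-- 2-cycles, and that is enough to find, for any two paths, an end of one lying in
-- a different row and column from an end of the other.
module Submission where

open import Defs
open import Data.Nat using (ℕ; _≤_; _*_)
open import Data.Nat.DivMod using (_/_)

open import Data.Bool using (Bool; true; false)
open import Data.Empty using (⊥-elim)
open import Data.Fin using (Fin; zero; suc; toℕ; fromℕ; inject₁; inject≤; combine; remQuot)
open import Data.Fin.Patterns using (0F; 1F; 2F)
open import Data.Fin.Properties
  using (_≟_; any?; inject≤-injective; combine-injective; *↔×; fromℕ≢inject₁; inject₁-injective; toℕ-inject₁)
open import Data.List using ([]; _∷_)
open import Data.List.Relation.Unary.All using (_∷_)
open import Data.List.Relation.Unary.AllPairs using (_∷_)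
open import Data.Nat using (s≤s; _+_)
open import Data.Nat.DivMod using (m/n*n≤m)
open import Data.Nat.Properties using (≤-refl; m≢1+n+m)
open import Data.Product using (∃; ∃₂; _×_; _,_; proj₁; proj₂)
open import Data.Product.Properties using (,-injectiveˡ; ,-injectiveʳ; ≡-dec)
open import Function using (id; _∘_)
open import Function.Bundles using (Injection)
open import Function.Definitions using (Injective)
open import Function.Properties.Inverse using (↔⇒↣)
open import Relation.Binary.Definitions using (DecidableEquality)
open import Relation.Binary.PropositionalEquality using (_≡_; _≢_; refl; sym; trans; cong)
open import Relation.Nullary using (¬_; Dec; does; yes; no)
open import Relation.Nullary.Decidable using (dec-true; dec-false)

pattern middle = 1F

data Link : Fin 3 → Fin 3 → Set where
  end-middle : ∀ {p} → p ≢ middle → Link p middle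
  middle-end : ∀ {p} → p ≢ middle → Link middle p

Link-sym : ∀ {p q} → Link p q → Link q p
Link-sym (end-middle p≢m) = middle-end p≢m
Link-sym (middle-end p≢m) = end-middle p≢m

Link⇒≢ : ∀ {p q} → Link p q → p ≢ q
Link⇒≢ (end-middle m≢m) refl = m≢m refl
Link⇒≢ (middle-end m≢m) refl = m≢m refl

Link-nonbacktracking : ∀ {p₀ p₁ p₂ p₃} → Link p₀ p₁ → Link p₁ p₂ → Link p₂ p₃ →
                       p₀ ≢ p₂ → p₁ ≡ p₃
Link-nonbacktracking (end-middle _)   (middle-end _)   (end-middle _) _   = refl
Link-nonbacktracking (end-middle _)   (middle-end p≢m) (middle-end _) _   = ⊥-elim (p≢m refl)
Link-nonbacktracking (middle-end _)   (end-middle _)   _              m≢m = ⊥-elim (m≢m refl)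
Link-nonbacktracking (end-middle _)   (end-middle m≢m) _              _   = ⊥-elim (m≢m refl)
Link-nonbacktracking (middle-end m≢m) (middle-end _)   _              _   = ⊥-elim (m≢m refl)

module _ {G : Graph} (v : Fin 3 → V G) (v-adj : ∀ {p q} → Link p q → Adj G (v p) (v q)) where

  path₃ : Subgraph G
  path₃ = record
    { Vs      = λ x → ∃ λ p → v p ≡ x
    ; Es      = λ x y → ∃₂ λ p q → Link p q × v p ≡ x × v q ≡ y
    ; Es-sym  = λ { (p , q , l , refl , refl) → q , p , Link-sym l , refl , refl }
    ; Es-adj  = λ { (p , q , l , refl , refl) → v-adj l }
    ; Es-vert = λ { (p , q , l , refl , refl) → (p , refl) , (q , refl) }
    }

  edge : ∀ {p q} → Link p q → Es path₃ (v p) (v q)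
  edge {p} {q} l = p , q , l , refl , refl

  walk-via-middle : ∀ p q → Walk path₃ (v p) (v q)
  walk-via-middle p q = to-middle p (from-middle q)
    where
    from-middle : ∀ q → Walk path₃ (v middle) (v q)
    from-middle q with q ≟ middle
    ... | yes refl = here
    ... | no q≢m   = step (edge (middle-end q≢m)) here

    to-middle : ∀ p {x} → Walk path₃ (v middle) x → Walk path₃ (v p) x
    to-middle p w with p ≟ middle
    ... | yes refl = w
    ... | no p≢m   = step (edge (end-middle p≢m)) w

  module _ (v-injective : Injective _≡_ _≡_ v) where

    path₃-nonbacktracking : ∀ {x₀ x₁ x₂ x₃} →
                            Es path₃ x₀ x₁ → Es path₃ x₁ x₂ → Es path₃ x₂ x₃ → x₀ ≢ x₂ → x₁ ≡ x₃
    path₃-nonbacktracking (_ , _ , l₀₁ , refl , refl) (_ , _ , l₁₂ , e₁ , refl) (_ , _ , l₂₃ , e₂ , refl) x₀≢x₂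
      with refl ← v-injective e₁ | refl ← v-injective e₂
      = cong v (Link-nonbacktracking l₀₁ l₁₂ l₂₃ (x₀≢x₂ ∘ cong v))

    -- The vertex after x₂ on the cycle (x₃, or x₀ for a triangle) would have to be x₁.
    path₃-acyclic : ¬ Cycle path₃
    path₃-acyclic record { rest = [] ; len≥3 = s≤s () }
    path₃-acyclic record { rest = _ ∷ [] ; len≥3 = s≤s (s≤s ()) }
    path₃-acyclic record { rest = _ ∷ _ ∷ [] ; distinct = (x₀≢x₁ ∷ x₀≢x₂ ∷ _) ∷ _
                         ; chain = cons e₀₁ (cons e₁₂ one) ; closing = _ , refl , e₂₀ }
      = x₀≢x₁ (sym (path₃-nonbacktracking e₀₁ e₁₂ e₂₀ x₀≢x₂))
    path₃-acyclic record { rest = _ ∷ _ ∷ _ ∷ _ ; distinct = (_ ∷ x₀≢x₂ ∷ _) ∷ (_ ∷ x₁≢x₃ ∷ _) ∷ _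
                         ; chain = cons e₀₁ (cons e₁₂ (cons e₂₃ _)) }
      = x₁≢x₃ (path₃-nonbacktracking e₀₁ e₁₂ e₂₃ x₀≢x₂)

    path₃-isTree : IsTree path₃
    path₃-isTree = record
      { nonempty  = v middle , middle , refl
      ; connected = λ { (p , refl) (q , refl) → walk-via-middle p q }
      ; acyclic   = path₃-acyclic
      }

module _ {G : Graph} (_≟ᵥ_ : DecidableEquality (V G)) {m : ℕ} (path : Fin m → Fin 3 → V G)
         (path-injective : ∀ {k k' p p'} → path k p ≡ path k' p' → k ≡ k' × p ≡ p')
         (path-adj : ∀ k {p q} → Link p q → Adj G (path k p) (path k q))
         (ends-adjacent : ∀ {k k'} → k ≢ k' →
           ∃₂ λ e e' → e ≢ middle × e' ≢ middle × Adj G (path k e) (path k' e'))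
         where

  middle? : ∀ x → Dec (∃ λ k → x ≡ path k middle)
  middle? x = any? λ k → x ≟ᵥ path k middle

  isMiddle : V G → Bool
  isMiddle x = does (middle? x)

  isMiddle-middle : ∀ k → isMiddle (path k middle) ≡ true
  isMiddle-middle k = dec-true (middle? _) (k , refl)

  isMiddle-end : ∀ k {e} → e ≢ middle → isMiddle (path k e) ≡ false
  isMiddle-end k e≢m = dec-false (middle? _) λ (_ , eq) → e≢m (proj₂ (path-injective eq))

  isMiddle-proper : ∀ k {p q} → Link p q → isMiddle (path k p) ≢ isMiddle (path k q)
  isMiddle-proper k (end-middle e≢m) eq with () ← trans (sym (isMiddle-end k e≢m)) (trans eq (isMiddle-middle k))
  isMiddle-proper k (middle-end e≢m) eq with () ← trans (sym (isMiddle-middle k)) (trans eq (isMiddle-end k e≢m))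

  paths₃⇒oddKMinorModel : OddKMinorModel G m
  paths₃⇒oddKMinorModel = record
    { Z        = λ k → path₃ (path k) (path-adj k)
    ; trees    = λ k → path₃-isTree (path k) (path-adj k) (proj₂ ∘ path-injective)
    ; disjoint = λ { k≢k' _ (p , refl) (p' , eq) → k≢k' (sym (proj₁ (path-injective eq))) }
    ; colour   = isMiddle
    ; proper   = λ { k (p , q , l , refl , refl) → isMiddle-proper k l }
    ; monochromatic-link = λ {k} {k'} k≢k' →
        let e , e' , e≢m , e'≢m , adj = ends-adjacent k≢k'
        in  path k e , path k' e' , (e , refl) , (e' , refl) , adj ,
            trans (isMiddle-end k e≢m) (sym (isMiddle-end k' e'≢m))
    }

remQuot-injective : ∀ {m} n → Injective _≡_ _≡_ (remQuot {m} n)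
remQuot-injective n = Injection.injective (↔⇒↣ *↔×)

module _ (t s : ℕ) (σ : Fin t → Fin t) (σ-injective : Injective _≡_ _≡_ σ)
         (σ-fixed-point-free : ∀ i → σ i ≢ i) (σ²-fixed-point-free : ∀ i → σ (σ i) ≢ i) where

  row : Fin 3 → Fin t → Fin t
  row 0F = id
  row 1F = σ ∘ σ
  row 2F = σ

  row-injective : ∀ p → Injective _≡_ _≡_ (row p)
  row-injective 0F eq = eq
  row-injective 1F eq = σ-injective (σ-injective eq)
  row-injective 2F eq = σ-injective eq

  row-link : ∀ {p q} i → Link p q → row p i ≢ row q i
  row-link {0F}     i (end-middle _)   = σ²-fixed-point-free i ∘ sym
  row-link {2F}     i (end-middle _)   = σ-fixed-point-free i ∘ σ-injective ∘ sym
  row-link {1F}     i (end-middle m≢m) = ⊥-elim (m≢m refl)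
  row-link {q = 0F} i (middle-end _)   = σ²-fixed-point-free i
  row-link {q = 2F} i (middle-end _)   = σ-fixed-point-free i ∘ σ-injective
  row-link {q = 1F} i (middle-end m≢m) = ⊥-elim (m≢m refl)

  slot : Fin (s / 3) → Fin 3 → Fin s
  slot b p = inject≤ (combine b p) (m/n*n≤m s 3)

  slot-injective : ∀ {b b' p p'} → slot b p ≡ slot b' p' → b ≡ b' × p ≡ p'
  slot-injective {b} {b'} {p} {p'} eq = combine-injective b p b' p' (inject≤-injective _ _ _ _ eq)

  vertex : Fin t × Fin (s / 3) → Fin 3 → Fin t × Fin s
  vertex (i , b) p = row p i , slot b p

  vertex-injective : ∀ {x y p p'} → vertex x p ≡ vertex y p' → x ≡ y × p ≡ p'
  vertex-injective {i , b} {p = p} eq with refl , refl ← slot-injective (,-injectiveʳ eq)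
    = cong (_, b) (row-injective p (,-injectiveˡ eq)) , refl

  vertex-adj : ∀ x {p q} → Link p q → Adj (K t ⊗ K s) (vertex x p) (vertex x q)
  vertex-adj (i , b) l = row-link i l , Link⇒≢ l ∘ proj₂ ∘ slot-injective

  vertex-ends-adjacent : ∀ x y →
    ∃₂ λ e e' → e ≢ middle × e' ≢ middle × Adj (K t ⊗ K s) (vertex x e) (vertex y e')
  vertex-ends-adjacent (i , b) (i' , b') with b ≟ b'
  ... | no b≢b' with i ≟ i'
  ...   | no i≢i'  = 0F , 0F , (λ ()) , (λ ()) , i≢i' , b≢b' ∘ proj₁ ∘ slot-injective
  ...   | yes refl = 0F , 2F , (λ ()) , (λ ()) , σ-fixed-point-free i ∘ sym , b≢b' ∘ proj₁ ∘ slot-injective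
  vertex-ends-adjacent (i , b) (i' , b) | yes refl with i ≟ σ i'
  ... | no i≢σi' = 0F , 2F , (λ ()) , (λ ()) , i≢σi' , (λ ()) ∘ proj₂ ∘ slot-injective
  ... | yes refl = 2F , 0F , (λ ()) , (λ ()) , σ²-fixed-point-free i' , (λ ()) ∘ proj₂ ∘ slot-injective

  K⊗K-oddKMinorModel : OddKMinorModel (K t ⊗ K s) (t * (s / 3))
  K⊗K-oddKMinorModel = paths₃⇒oddKMinorModel (≡-dec _≟_ _≟_) (vertex ∘ remQuot (s / 3))
    (λ eq → let x≡y , p≡p' = vertex-injective eq in remQuot-injective (s / 3) x≡y , p≡p')
    (λ k → vertex-adj (remQuot (s / 3) k))
    (λ {k} {k'} _ → vertex-ends-adjacent (remQuot (s / 3) k) (remQuot (s / 3) k'))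

rotate : ∀ {n} → Fin (1 + n) → Fin (1 + n)
rotate {n} zero = fromℕ n
rotate (suc i)  = inject₁ i

rotate-injective : ∀ {n} → Injective _≡_ _≡_ (rotate {n})
rotate-injective {_} {zero}  {zero}  _  = refl
rotate-injective {_} {zero}  {suc j} eq = ⊥-elim (fromℕ≢inject₁ eq)
rotate-injective {_} {suc i} {zero}  eq = ⊥-elim (fromℕ≢inject₁ (sym eq))
rotate-injective {_} {suc i} {suc j} eq = cong suc (inject₁-injective eq)

rotate-fixed-point-free : ∀ {n} (i : Fin (2 + n)) → rotate i ≢ i
rotate-fixed-point-free zero    ()
rotate-fixed-point-free (suc i) eq = m≢1+n+m (toℕ i) {0} (trans (sym (toℕ-inject₁ i)) (cong toℕ eq))

rotate²-fixed-point-free : ∀ {n} (i : Fin (3 + n)) → rotate (rotate i) ≢ i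
rotate²-fixed-point-free zero          ()
rotate²-fixed-point-free (suc zero)    ()
rotate²-fixed-point-free (suc (suc i)) eq = m≢1+n+m (toℕ i) {1} (trans (sym toℕ-inject₁²) (cong toℕ eq))
  where
  toℕ-inject₁² : toℕ (inject₁ (inject₁ i)) ≡ toℕ i
  toℕ-inject₁² = trans (toℕ-inject₁ (inject₁ i)) (toℕ-inject₁ i)

theorem12 : ∀ (t s : ℕ) → 4 ≤ t → 3 ≤ s → oh≥ (K t ⊗ K s) (t * (s / 3))
theorem12 t s (s≤s (s≤s (s≤s _))) _ =
  t * (s / 3) , ≤-refl ,
  K⊗K-oddKMinorModel t s rotate rotate-injective rotate-fixed-point-free rotate²-fixed-point-free
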